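{- Let $G$ be a finite bipartite graph (multiple edges allowed, no loops), let $k\geq 1$ be an integer, and let $A_k$ be a $k$-edge-colorable subgraph of $G$ with $|E(A_k)|<\nu_k(G)$. Then $G$ contains an $A_k$-augmenting path.
   Context: Graphs are finite, undirected, without loops, possibly with multiple edges. For an integer $k\geq 0$, a graph is $k$-edge-colorable if its edges can be assigned colors from a set of $k$ colors so that adjacent edges receive different colors; $\nu_k(G)$ denotes the maximum number of edges of a $k$-edge-colorable subgraph of $G$. $d_{A}(x)$ denotes the degree of vertex $x$ in the subgraph $A$. Given a $k$-edge-colorable subgraph $A_k$ of $G$, a simple path $P$ in $G$ from $u$ to $v$ is called $A_k$-augmenting if it has odd length, its even-numbered edges (2nd, 4th, ...) belong to $E(A_k)$, its odd-numbered edges (1st, 3rd, ...) do not belong to $E(A_k)$, and $d_{A_k}(u)\leq k-1$ and $d_{A_k}(v)\leq k-1$. -}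

module Defs where

open import Data.Nat using (ℕ; suc; _≤_; _<_; _∸_; _%_)
open import Data.Bool using (Bool; _∨_)
open import Data.Fin using (Fin; toℕ; inject₁) renaming (suc to fsuc)
open import Data.Fin.Properties using (_≟_)
open import Data.Fin.Subset using (Subset; _∈_; _∩_; ∣_∣)
open import Data.Vec using (tabulate)
open import Data.Product using (_×_; _,_; proj₁; proj₂; Σ; ∃)
open import Data.Sum using (_⊎_)
open import Relation.Nullary using (¬_)
open import Relation.Nullary.Decidable using (⌊_⌋)
open import Relation.Binary.PropositionalEquality using (_≡_; _≢_)
open import Function.Definitions using (Injective)

record Multigraph : Set where
  field
    V : ℕ
    E : ℕ
    ends : Fin E → Fin V × Fin V
    loopless : ∀ e → proj₁ (ends e) ≢ proj₂ (ends e)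
open Multigraph public

Bipartite : Multigraph → Set
Bipartite G = Σ (Fin (V G) → Bool) λ side →
  ∀ e → side (proj₁ (ends G e)) ≢ side (proj₂ (ends G e))

-- A subgraph is given by its edge set (vertices play no role for
-- edge counts, colourability, degrees, or paths in G).
SubG : Multigraph → Set
SubG G = Subset (E G)

Incident : (G : Multigraph) → Fin (E G) → Fin (V G) → Set
Incident G e x = x ≡ proj₁ (ends G e) ⊎ x ≡ proj₂ (ends G e)

Joins : (G : Multigraph) → Fin (E G) → Fin (V G) → Fin (V G) → Set
Joins G e a b = ends G e ≡ (a , b) ⊎ ends G e ≡ (b , a)

EdgeColorable : (G : Multigraph) → ℕ → SubG G → Set
EdgeColorable G k A = Σ (Fin (E G) → Fin k) λ c →
  ∀ e f → e ∈ A → f ∈ A → e ≢ f →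
  (Σ (Fin (V G)) λ x → Incident G e x × Incident G f x) → c e ≢ c f

size : {G : Multigraph} → SubG G → ℕ
size A = ∣ A ∣

incSet : (G : Multigraph) → Fin (V G) → SubG G
incSet G x = tabulate λ e → ⌊ x ≟ proj₁ (ends G e) ⌋ ∨ ⌊ x ≟ proj₂ (ends G e) ⌋

degree : (G : Multigraph) → SubG G → Fin (V G) → ℕ
degree G A x = ∣ A ∩ incSet G x ∣

IsNu : (G : Multigraph) → ℕ → ℕ → Set
IsNu G k ν = (Σ (SubG G) λ B → EdgeColorable G k B × ∣ B ∣ ≡ ν)
           × (∀ B → EdgeColorable G k B → ∣ B ∣ ≤ ν)

-- An A-augmenting path (for k colours): vertices vs 0..L, edges es 0..L-1,
-- edge i joins vs i and vs (i+1); simple (vertices pairwise distinct);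
-- L odd; the (1-indexed) even-numbered edges, i.e. 0-indexed odd i,
-- are exactly those in A; both ends have A-degree ≤ k-1.
record AugmentingPath (G : Multigraph) (k : ℕ) (A : SubG G) : Set where
  field
    L : ℕ
    vs : Fin (suc L) → Fin (V G)
    es : Fin L → Fin (E G)
    joins : ∀ i → Joins G (es i) (vs (inject₁ i)) (vs (fsuc i))
    simple : Injective _≡_ _≡_ vs
    oddLength : L % 2 ≡ 1
    inA⇒oddIndex : ∀ i → es i ∈ A → toℕ i % 2 ≡ 1
    oddIndex⇒inA : ∀ i → toℕ i % 2 ≡ 1 → es i ∈ A
    startDeg : degree G A (vs Data.Fin.zero) ≤ k ∸ 1
    endDeg : degree G A (vs (Data.Fin.fromℕ L)) ≤ k ∸ 1

-- The proof combines three independent facts.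
--   * Degree bound (the easy half of König's theorem): in a properly k-edge-coloured
--     subgraph the edges at a vertex have pairwise distinct colours, so every degree
--     is at most k.
--   * Exchange lemma (any loopless multigraph): if |A| < |B| there is an odd walk
--     alternating between B ∖ A and A ∖ B whose two end vertices have deg_A < deg_B.
--     By the handshake lemma some vertex u has deg_A u < deg_B u, hence carries an
--     edge e = uv of B ∖ A; either v has a surplus too, or v carries an edge f = vw of
--     A ∖ B, and the claim for (A ∖ f, B ∖ e), by induction on |B|, lifts back after
--     re-routing an end at w through f and e to u.
--   * Shortcutting: in a bipartite graph the parity of an alternating walk is fixed
--     by its end vertices, so closed sub-walks can be cut out, leaving a simple
--     alternating walk with the same ends and the same class of first edge.
module Submission where

open import Defs
open import Data.Nat using (ℕ; zero; suc; _+_; _∸_; _%_; _≤_; _<_; z≤n; s≤s; _<?_)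
open import Data.Nat.Properties
  using (≤-refl; ≤-reflexive; <-≤-trans; ≮⇒≥; n≮0; ≤-pred; <⇒≤pred; m<m+n; pred[m∸n]≡m∸[1+n];
         +-comm; +-identityʳ; +-mono-≤; +-monoˡ-≤; +-mono-<; +-mono-<-≤; +-cancelˡ-<; +-cancelʳ-<;
         +-0-commutativeMonoid; module ≤-Reasoning)
open import Data.Nat.DivMod using ([m+n]%n≡m%n)
open import Data.Bool using (Bool; true; false; _∧_; _∨_; not; if_then_else_; _xor_)
open import Data.Bool.Properties
  using (∧-conicalˡ; ∧-conicalʳ; ∧-identityʳ; not-involutive; not-injective; ¬-not;
         xor-same; xor-identityʳ; not-distribˡ-xor; not-distribʳ-xor)
open import Data.Fin using (Fin; zero; suc; toℕ; inject₁; fromℕ)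
open import Data.Fin.Properties using (_≟_; suc-injective)
open import Data.Fin.Subset using (Subset; ∣_∣; _∩_; _∈_)
open import Data.Vec using (_∷_; []; lookup)
open import Data.Vec.Properties using (lookup-zipWith; lookup∘tabulate; lookup⇒[]=; []=⇒lookup)
open import Data.Product using (_×_; _,_; proj₁; proj₂; Σ; ∃)
open import Data.Sum using (_⊎_; inj₁; inj₂; swap)
open import Data.Empty using (⊥-elim)
open import Data.Unit using (⊤; tt)
open import Function.Definitions using (Injective)
open import Relation.Nullary using (yes; no)
open import Relation.Nullary.Decidable using (⌊_⌋)
open import Relation.Binary.PropositionalEquality
open import Algebra.Properties.CommutativeMonoid.Sum +-0-commutativeMonoid
  using (sum; sum-syntax; sum-replicate-zero; sum-cong-≗; ∑-distrib-+; ∑-comm)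

∑-point : ∀ {n} (g : Fin n) (c : ℕ) → ∑[ i < n ] (if ⌊ i ≟ g ⌋ then c else 0) ≡ c
∑-point {suc n} zero c = trans (cong (c +_) (sum-replicate-zero n)) (+-identityʳ c)
∑-point {suc n} (suc g) c = trans (sum-cong-≗ shift) (∑-point g c)
  where
  shift : ∀ i → (if ⌊ suc i ≟ suc g ⌋ then c else 0) ≡ (if ⌊ i ≟ g ⌋ then c else 0)
  shift i with i ≟ g
  ... | yes _ = refl
  ... | no _ = refl

∑-split-at : ∀ {n} (g : Fin n) (f : Fin n → ℕ) →
             sum f ≡ ∑[ i < n ] (if ⌊ i ≟ g ⌋ then 0 else f i) + f g
∑-split-at {n} g f = begin
  sum f                                                            ≡⟨ sum-cong-≗ pointwise ⟩
  ∑[ i < n ] ((if ⌊ i ≟ g ⌋ then 0 else f i) + (if ⌊ i ≟ g ⌋ then f g else 0))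
                                                                   ≡⟨ ∑-distrib-+ rest spike ⟩
  ∑[ i < n ] (if ⌊ i ≟ g ⌋ then 0 else f i) + ∑[ i < n ] (if ⌊ i ≟ g ⌋ then f g else 0)
                                                                   ≡⟨ cong (sum rest +_) (∑-point g (f g)) ⟩
  ∑[ i < n ] (if ⌊ i ≟ g ⌋ then 0 else f i) + f g                  ∎
  where
  open ≡-Reasoning
  rest spike : Fin n → ℕ
  rest i = if ⌊ i ≟ g ⌋ then 0 else f i
  spike i = if ⌊ i ≟ g ⌋ then f g else 0
  pointwise : ∀ i → f i ≡ (if ⌊ i ≟ g ⌋ then 0 else f i) + (if ⌊ i ≟ g ⌋ then f g else 0)
  pointwise i with i ≟ g
  ... | yes refl = refl
  ... | no _ = sym (+-identityʳ (f i))

∑-mono-≤ : ∀ {n} {f g : Fin n → ℕ} → (∀ i → f i ≤ g i) → sum f ≤ sum g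
∑-mono-≤ {zero} f≤g = z≤n
∑-mono-≤ {suc n} f≤g = +-mono-≤ (f≤g zero) (∑-mono-≤ (λ i → f≤g (suc i)))

∑-<⇒∃< : ∀ {n} (f g : Fin n → ℕ) → sum f < sum g → ∃ λ i → f i < g i
∑-<⇒∃< {zero} f g ()
∑-<⇒∃< {suc n} f g ∑f<∑g with f zero <? g zero
... | yes f₀<g₀ = zero , f₀<g₀
... | no f₀≮g₀ with ∑-<⇒∃< (λ i → f (suc i)) (λ i → g (suc i))
                      (+-cancelˡ-< (f zero) _ _ (<-≤-trans ∑f<∑g (+-monoˡ-≤ _ (≮⇒≥ f₀≮g₀))))
... | i , fi<gi = suc i , fi<gi

∑-one : ∀ n → ∑[ i < n ] 1 ≡ n
∑-one zero = refl
∑-one (suc n) = cong suc (∑-one n)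

bit : Bool → ℕ
bit true = 1
bit false = 0

count : ∀ {n} → (Fin n → Bool) → ℕ
count {n} P = ∑[ i < n ] bit (P i)

∣∣≡count : ∀ {n} (p : Subset n) → ∣ p ∣ ≡ count (lookup p)
∣∣≡count [] = refl
∣∣≡count (true ∷ p) = cong suc (∣∣≡count p)
∣∣≡count (false ∷ p) = ∣∣≡count p

count-<⇒∃ : ∀ {n} (P Q : Fin n → Bool) → count P < count Q → ∃ λ i → P i ≡ false × Q i ≡ true
count-<⇒∃ P Q P<Q with ∑-<⇒∃< (λ i → bit (P i)) (λ i → bit (Q i)) P<Q
... | i , Pi<Qi = i , bit-< (P i) (Q i) Pi<Qi
  where
  bit-< : ∀ a b → bit a < bit b → a ≡ false × b ≡ true
  bit-< false true _ = refl , refl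
  bit-< true true (s≤s ())

count-unique≤1 : ∀ {n} (P : Fin n → Bool) → (∀ i j → P i ≡ true → P j ≡ true → i ≡ j) → count P ≤ 1
count-unique≤1 {zero} P unique = z≤n
count-unique≤1 {suc n} P unique with P zero in P₀
... | false =
  count-unique≤1 (λ i → P (suc i)) (λ i j Pi Pj → suc-injective (unique (suc i) (suc j) Pi Pj))
... | true = s≤s (≤-reflexive (trans (sum-cong-≗ rest-false) (sum-replicate-zero n)))
  where
  rest-false : ∀ i → bit (P (suc i)) ≡ 0
  rest-false i with P (suc i) in Pi
  ... | false = refl
  ... | true with () ← unique zero (suc i) P₀ Pi

-- Pigeonhole for counts: if a colouring c : Fin n → Fin k is injective on the
-- elements of P, then P has at most k elements (each colour class has ≤ 1).
count-injective≤ : ∀ {n k} (P : Fin n → Bool) (c : Fin n → Fin k) →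
                   (∀ i j → P i ≡ true → P j ≡ true → c i ≡ c j → i ≡ j) → count P ≤ k
count-injective≤ {n} {k} P c injective = begin
  count P
    ≡⟨ sum-cong-≗ (λ i → sym (∑-point (c i) (bit (P i)))) ⟩
  ∑[ i < n ] ∑[ γ < k ] coloured i γ
    ≡⟨ ∑-comm coloured ⟩
  ∑[ γ < k ] ∑[ i < n ] coloured i γ
    ≡⟨ sum-cong-≗ (λ γ → sum-cong-≗ (fibre γ)) ⟩
  ∑[ γ < k ] count (λ i → P i ∧ ⌊ γ ≟ c i ⌋)
    ≤⟨ ∑-mono-≤ (λ γ → count-unique≤1 _ (sameColour γ)) ⟩
  ∑[ γ < k ] 1
    ≡⟨ ∑-one k ⟩
  k ∎
  where
  open ≤-Reasoning
  coloured : Fin n → Fin k → ℕ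
  coloured i γ = if ⌊ γ ≟ c i ⌋ then bit (P i) else 0
  fibre : ∀ γ i → coloured i γ ≡ bit (P i ∧ ⌊ γ ≟ c i ⌋)
  fibre γ i with γ ≟ c i | P i
  ... | yes _ | true = refl
  ... | yes _ | false = refl
  ... | no _ | true = refl
  ... | no _ | false = refl
  sameColour : ∀ γ i j → P i ∧ ⌊ γ ≟ c i ⌋ ≡ true → P j ∧ ⌊ γ ≟ c j ⌋ ≡ true → i ≡ j
  sameColour γ i j Pi Pj with γ ≟ c i | γ ≟ c j | P i in Pi-true | P j in Pj-true
  ... | yes γ≡ci | yes γ≡cj | true | true = injective i j Pi-true Pj-true (trans (sym γ≡ci) γ≡cj)

_∖_ : ∀ {n} → (Fin n → Bool) → Fin n → (Fin n → Bool)
(P ∖ g) i = P i ∧ not ⌊ i ≟ g ⌋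

∖-true : ∀ {n} {P : Fin n → Bool} {g i} → (P ∖ g) i ≡ true → P i ≡ true × i ≢ g
∖-true {P = P} {g} {i} Pi with P i | i ≟ g
... | true | no i≢g = refl , i≢g

∖-false : ∀ {n} {P : Fin n → Bool} {g i} → (P ∖ g) i ≡ false → i ≢ g → P i ≡ false
∖-false {P = P} {g} {i} Pi i≢g with P i | i ≟ g
... | false | _ = refl
... | true | yes i≡g = ⊥-elim (i≢g i≡g)

count-∖ : ∀ {n} (P Q : Fin n → Bool) {g} → P g ≡ true →
          count (λ i → P i ∧ Q i) ≡ count (λ i → (P ∖ g) i ∧ Q i) + bit (Q g)
count-∖ P Q {g} Pg = trans (∑-split-at g _) (cong₂ _+_ (sum-cong-≗ zeroed) (cong (λ b → bit (b ∧ Q g)) Pg))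
  where
  zeroed : ∀ i → (if ⌊ i ≟ g ⌋ then 0 else bit (P i ∧ Q i)) ≡ bit ((P ∖ g) i ∧ Q i)
  zeroed i with i ≟ g | P i
  ... | yes _ | true = refl
  ... | yes _ | false = refl
  ... | no _ | true = refl
  ... | no _ | false = refl

count-remove : ∀ {n} (P : Fin n → Bool) {g} → P g ≡ true → count P ≡ count (P ∖ g) + 1
count-remove P {g} Pg = begin
  count P                            ≡⟨ sum-cong-≗ (λ i → cong bit (sym (∧-identityʳ (P i)))) ⟩
  count (λ i → P i ∧ true)           ≡⟨ count-∖ P (λ _ → true) Pg ⟩
  count (λ i → (P ∖ g) i ∧ true) + 1 ≡⟨ cong (_+ 1) (sum-cong-≗ (λ i → cong bit (∧-identityʳ ((P ∖ g) i)))) ⟩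
  count (P ∖ g) + 1                  ∎
  where open ≡-Reasoning

count-∖-< : ∀ {n} (P Q : Fin n → Bool) {g h} → P g ≡ true → Q h ≡ true →
            count P < count Q → count (P ∖ g) < count (Q ∖ h)
count-∖-< P Q Pg Qh P<Q = +-cancelʳ-< 1 _ _ (subst₂ _<_ (count-remove P Pg) (count-remove Q Qh) P<Q)

count-∖-≤ : ∀ {n} (P : Fin n → Bool) {g m} → P g ≡ true → count P ≤ suc m → count (P ∖ g) ≤ m
count-∖-≤ P Pg P≤1+m = ≤-pred (subst (_≤ _) (trans (count-remove P Pg) (+-comm _ 1)) P≤1+m)

module Incidence (G : Multigraph) where

  EdgeSet : Set
  EdgeSet = Fin (E G) → Bool

  inc : Fin (E G) → Fin (V G) → Bool
  inc e x = ⌊ x ≟ proj₁ (ends G e) ⌋ ∨ ⌊ x ≟ proj₂ (ends G e) ⌋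

  deg : EdgeSet → Fin (V G) → ℕ
  deg S x = count (λ e → S e ∧ inc e x)

  degree≡deg : ∀ (S : SubG G) x → degree G S x ≡ deg (lookup S) x
  degree≡deg S x = trans (∣∣≡count (S ∩ incSet G x)) (sum-cong-≗ λ e →
    cong bit (trans (lookup-zipWith _∧_ e S (incSet G x)) (cong (lookup S e ∧_) (lookup∘tabulate _ e))))

  inc-sound : ∀ {e x} → inc e x ≡ true → Incident G e x
  inc-sound {e} {x} ie with x ≟ proj₁ (ends G e) | x ≟ proj₂ (ends G e)
  ... | yes x≡e₁ | _ = inj₁ x≡e₁
  ... | no _ | yes x≡e₂ = inj₂ x≡e₂

  inc-end₁ : ∀ {e} → inc e (proj₁ (ends G e)) ≡ true
  inc-end₁ {e} with proj₁ (ends G e) ≟ proj₁ (ends G e)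
  ... | yes _ = refl
  ... | no e₁≢e₁ = ⊥-elim (e₁≢e₁ refl)

  inc-end₂ : ∀ {e} → inc e (proj₂ (ends G e)) ≡ true
  inc-end₂ {e} with proj₂ (ends G e) ≟ proj₁ (ends G e) | proj₂ (ends G e) ≟ proj₂ (ends G e)
  ... | yes _ | _ = refl
  ... | no _ | yes _ = refl
  ... | no _ | no e₂≢e₂ = ⊥-elim (e₂≢e₂ refl)

  other-end : ∀ e u → inc e u ≡ true →
              ∃ λ v → Joins G e u v × inc e v ≡ true × (∀ z → inc e z ≡ true → z ≡ u ⊎ z ≡ v)
  other-end e u ie with inc-sound {e} {u} ie
  ... | inj₁ refl = proj₂ (ends G e) , inj₁ refl , inc-end₂ , λ z → inc-sound
  ... | inj₂ refl = proj₁ (ends G e) , inj₂ refl , inc-end₁ , λ z iz → swap (inc-sound iz)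

  deg-∖ : ∀ (S : EdgeSet) {g} → S g ≡ true → ∀ x → deg S x ≡ deg (S ∖ g) x + bit (inc g x)
  deg-∖ S Sg x = count-∖ S (λ e → inc e x) Sg

  deg-∖-< : ∀ (S : EdgeSet) {g} → S g ≡ true → ∀ x → inc g x ≡ true → deg (S ∖ g) x < deg S x
  deg-∖-< S {g} Sg x gx =
    subst (deg (S ∖ g) x <_) (sym (trans (deg-∖ S Sg x) (cong (λ b → deg (S ∖ g) x + bit b) gx)))
          (m<m+n _ (s≤s z≤n))

  -- Handshake lemma: every edge has exactly two (distinct) ends.
  handshake : ∀ (S : EdgeSet) → ∑[ x < V G ] deg S x ≡ count S + count S
  handshake S = begin
    ∑[ x < V G ] ∑[ e < E G ] bit (S e ∧ inc e x)   ≡⟨ ∑-comm (λ x e → bit (S e ∧ inc e x)) ⟩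
    ∑[ e < E G ] ∑[ x < V G ] bit (S e ∧ inc e x)   ≡⟨ sum-cong-≗ edge-contribution ⟩
    ∑[ e < E G ] (bit (S e) + bit (S e))           ≡⟨ ∑-distrib-+ (λ e → bit (S e)) (λ e → bit (S e)) ⟩
    count S + count S                              ∎
    where
    open ≡-Reasoning
    ∑-bit-point : ∀ y → ∑[ x < V G ] bit ⌊ x ≟ y ⌋ ≡ 1
    ∑-bit-point y = trans (sum-cong-≗ bit-if) (∑-point y 1)
      where
      bit-if : ∀ x → bit ⌊ x ≟ y ⌋ ≡ (if ⌊ x ≟ y ⌋ then 1 else 0)
      bit-if x with x ≟ y
      ... | yes _ = refl
      ... | no _ = refl
    two-ends : ∀ e x → bit (inc e x) ≡ bit ⌊ x ≟ proj₁ (ends G e) ⌋ + bit ⌊ x ≟ proj₂ (ends G e) ⌋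
    two-ends e x with x ≟ proj₁ (ends G e) | x ≟ proj₂ (ends G e)
    ... | yes x≡e₁ | yes x≡e₂ = ⊥-elim (loopless G e (trans (sym x≡e₁) x≡e₂))
    ... | yes _ | no _ = refl
    ... | no _ | yes _ = refl
    ... | no _ | no _ = refl
    ends-count : ∀ e → ∑[ x < V G ] bit (inc e x) ≡ 2
    ends-count e = begin
      ∑[ x < V G ] bit (inc e x)
        ≡⟨ sum-cong-≗ (two-ends e) ⟩
      ∑[ x < V G ] (bit ⌊ x ≟ e₁ ⌋ + bit ⌊ x ≟ e₂ ⌋)
        ≡⟨ ∑-distrib-+ (λ x → bit ⌊ x ≟ e₁ ⌋) (λ x → bit ⌊ x ≟ e₂ ⌋) ⟩
      ∑[ x < V G ] bit ⌊ x ≟ e₁ ⌋ + ∑[ x < V G ] bit ⌊ x ≟ e₂ ⌋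
        ≡⟨ cong₂ _+_ (∑-bit-point e₁) (∑-bit-point e₂) ⟩
      2 ∎
      where
      e₁ e₂ : Fin (V G)
      e₁ = proj₁ (ends G e)
      e₂ = proj₂ (ends G e)
    edge-contribution : ∀ e → ∑[ x < V G ] bit (S e ∧ inc e x) ≡ bit (S e) + bit (S e)
    edge-contribution e with S e
    ... | false = sum-replicate-zero (V G)
    ... | true = ends-count e

  surplus-vertex : ∀ (A B : EdgeSet) → count A < count B → ∃ λ u → deg A u < deg B u
  surplus-vertex A B A<B = ∑-<⇒∃< (deg A) (deg B)
    (subst₂ _<_ (sym (handshake A)) (sym (handshake B)) (+-mono-< A<B A<B))

  surplus-edge : ∀ (A B : EdgeSet) x → deg A x < deg B x →
                 ∃ λ e → A e ≡ false × B e ≡ true × inc e x ≡ true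
  surplus-edge A B x A<B with count-<⇒∃ (λ e → A e ∧ inc e x) (λ e → B e ∧ inc e x) A<B
  ... | e , Ae∧ie , Be∧ie with ∧-conicalˡ (B e) _ Be∧ie | ∧-conicalʳ _ (inc e x) Be∧ie
  ... | Be | ie rewrite ie = e , trans (sym (∧-identityʳ (A e))) Ae∧ie , Be , ie

  -- König's easy half: a properly k-edge-coloured subgraph has maximum degree at most k,
  -- since the edges at a vertex receive pairwise distinct colours.
  colourable⇒deg≤ : ∀ {k} (S : SubG G) → EdgeColorable G k S → ∀ x → deg (lookup S) x ≤ k
  colourable⇒deg≤ S (c , proper) x = count-injective≤ _ c distinct
    where
    distinct : ∀ e f → lookup S e ∧ inc e x ≡ true → lookup S f ∧ inc f x ≡ true → c e ≡ c f → e ≡ f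
    distinct e f Se Sf ce≡cf with e ≟ f
    ... | yes e≡f = e≡f
    ... | no e≢f = ⊥-elim (proper e f (member e Se) (member f Sf) e≢f
                            (x , inc-sound (∧-conicalʳ _ _ Se) , inc-sound (∧-conicalʳ _ _ Sf)) ce≡cf)
      where
      member : ∀ g → lookup S g ∧ inc g x ≡ true → g ∈ S
      member g Sg = lookup⇒[]= g S (∧-conicalˡ _ _ Sg)

odd : ℕ → Bool
odd zero = false
odd (suc n) = not (odd n)

%2≡bit-odd : ∀ n → n % 2 ≡ bit (odd n)
%2≡bit-odd zero = refl
%2≡bit-odd (suc zero) = refl
%2≡bit-odd (suc (suc n)) = begin
  (2 + n) % 2         ≡⟨ cong (_% 2) (+-comm 2 n) ⟩
  (n + 2) % 2         ≡⟨ [m+n]%n≡m%n n 2 ⟩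
  n % 2               ≡⟨ %2≡bit-odd n ⟩
  bit (odd n)         ≡⟨ cong bit (sym (not-involutive (odd n))) ⟩
  bit (odd (2 + n))   ∎
  where open ≡-Reasoning

odd⇒%2≡1 : ∀ n → odd n ≡ true → n % 2 ≡ 1
odd⇒%2≡1 n odd-n = trans (%2≡bit-odd n) (cong bit odd-n)

%2≡1⇒odd : ∀ n → n % 2 ≡ 1 → odd n ≡ true
%2≡1⇒odd n n%2≡1 with odd n | trans (sym (%2≡bit-odd n)) n%2≡1
... | true | _ = refl

-- An edge class C p e says that e may serve as an edge of
-- class p; along an alternating walk the classes of consecutive edges alternate.
-- `AltWalk C p x y` is such a walk from x to y whose first edge has class p and
-- whose last edge has class false; thus `AltWalk C false` consists of the walks
-- of odd length beginning and ending with class false, `AltWalk C true` of the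
-- walks of even length (possibly empty).
module Walks (G : Multigraph) where

  EdgeClass : Set₁
  EdgeClass = Bool → Fin (E G) → Set

  data AltWalk (C : EdgeClass) : Bool → Fin (V G) → Fin (V G) → Set where
    [] : ∀ {x} → AltWalk C true x x
    step : ∀ {p x z y} e → Joins G e x z → C p e → AltWalk C (not p) z y → AltWalk C p x y

  module _ {C : EdgeClass} where

    infixr 5 _++_
    _++_ : ∀ {p x y t} → AltWalk C p x y → AltWalk C true y t → AltWalk C p x t
    [] ++ w = w
    step e j c w ++ w′ = step e j c (w ++ w′)

    length : ∀ {p x y} → AltWalk C p x y → ℕ
    length [] = 0
    length (step e j c w) = suc (length w)

    vertex : ∀ {p x y} (w : AltWalk C p x y) → Fin (suc (length w)) → Fin (V G)
    vertex {x = x} w zero = x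
    vertex (step e j c w) (suc i) = vertex w i

    edge : ∀ {p x y} (w : AltWalk C p x y) → Fin (length w) → Fin (E G)
    edge (step e j c w) zero = e
    edge (step e j c w) (suc i) = edge w i

    joins-at : ∀ {p x y} (w : AltWalk C p x y) (i : Fin (length w)) →
               Joins G (edge w i) (vertex w (inject₁ i)) (vertex w (suc i))
    joins-at (step e j c w) zero = j
    joins-at (step e j c w) (suc i) = joins-at w i

    last-vertex : ∀ {p x y} (w : AltWalk C p x y) → vertex w (fromℕ (length w)) ≡ y
    last-vertex [] = refl
    last-vertex (step e j c w) = last-vertex w

    class-at : ∀ {p x y} (w : AltWalk C p x y) (i : Fin (length w)) → C (p xor odd (toℕ i)) (edge w i)
    class-at {p} (step e j c w) zero = subst (λ q → C q e) (sym (xor-identityʳ p)) c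
    class-at {p} (step e j c w) (suc i) =
      subst (λ q → C q (edge w i)) (trans (sym (not-distribˡ-xor p _)) (not-distribʳ-xor p _)) (class-at w i)

    length-parity : ∀ {p x y} (w : AltWalk C p x y) → odd (length w) ≡ not p
    length-parity [] = refl
    length-parity (step {p} e j c w) = trans (cong not (length-parity w)) (not-involutive (not p))

    Simple : ∀ {p x y} → AltWalk C p x y → Set
    Simple [] = ⊤
    Simple {x = x} (step e j c w) = (∀ i → vertex w i ≢ x) × Simple w

    simple⇒injective : ∀ {p x y} (w : AltWalk C p x y) → Simple w → Injective _≡_ _≡_ (vertex w)
    simple⇒injective [] _ {zero} {zero} _ = refl
    simple⇒injective (step e j c w) _ {zero} {zero} _ = refl
    simple⇒injective (step e j c w) (fresh , _) {zero} {suc i} x≡wᵢ = ⊥-elim (fresh i (sym x≡wᵢ))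
    simple⇒injective (step e j c w) (fresh , _) {suc i} {zero} wᵢ≡x = ⊥-elim (fresh i wᵢ≡x)
    simple⇒injective (step e j c w) (_ , simple) {suc i} {suc i′} wᵢ≡wᵢ′ =
      cong suc (simple⇒injective w simple wᵢ≡wᵢ′)

  map-class : ∀ {C D : EdgeClass} → (∀ {p e} → C p e → D p e) →
              ∀ {p x y} → AltWalk C p x y → AltWalk D p x y
  map-class f [] = []
  map-class f (step e j c w) = step e j (f c) (map-class f w)

-- In a bipartite graph the parity of an alternating walk is fixed by its ends, so
-- cutting out a closed sub-walk preserves the class of the first edge; repeating
-- this turns any alternating walk into a simple one (a path).
module Shortcut (G : Multigraph) (bip : Bipartite G) where

  open Walks G

  side : Fin (V G) → Bool
  side = proj₁ bip

  side-flip : ∀ {e x z} → Joins G e x z → side z ≡ not (side x)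
  side-flip {e} e-xz = ¬-not λ z≡x → proj₂ bip e (same-side e-xz z≡x)
    where
    same-side : ∀ {x z} → Joins G e x z → side z ≡ side x →
                side (proj₁ (ends G e)) ≡ side (proj₂ (ends G e))
    same-side (inj₁ e≡xz) z≡x rewrite e≡xz = sym z≡x
    same-side (inj₂ e≡zx) z≡x rewrite e≡zx = z≡x

  ends-parity : ∀ {C p x y} → AltWalk C p x y → side x xor side y ≡ not p
  ends-parity {x = x} [] = xor-same (side x)
  ends-parity {p = p} {x} {y} (step {z = z} e j c w) = not-injective (begin
    not (side x xor side y)   ≡⟨ not-distribˡ-xor (side x) (side y) ⟩
    not (side x) xor side y   ≡⟨ cong (_xor side y) (sym (side-flip j)) ⟩
    side z xor side y         ≡⟨ ends-parity w ⟩
    not (not p)               ∎)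
    where open ≡-Reasoning

  module _ {C : EdgeClass} where

    from-visit : ∀ {p x y} z (w : AltWalk C p x y) → Simple w →
                 (Σ Bool λ q → Σ (AltWalk C q z y) Simple) ⊎ (∀ i → vertex w i ≢ z)
    from-visit {p} {x} z w simple with x ≟ z
    ... | yes refl = inj₁ (p , w , simple)
    from-visit z [] _ | no x≢z = inj₂ λ { zero → x≢z }
    from-visit z (step e j c w) (_ , simple) | no x≢z with from-visit z w simple
    ... | inj₁ suffix = inj₁ suffix
    ... | inj₂ unvisited = inj₂ λ { zero → x≢z ; (suc i) → unvisited i }

    shortcut : ∀ {p x y} → AltWalk C p x y → Σ (AltWalk C p x y) Simple
    shortcut [] = [] , tt
    shortcut {p} {x} {y} (step e j c w) with shortcut w
    ... | w′ , simple with from-visit x w′ simple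
    ... | inj₂ fresh = step e j c w′ , fresh , simple
    ... | inj₁ (q , loop-free , simple′) =
      subst (λ r → Σ (AltWalk C r x y) Simple) same-class (loop-free , simple′)
      where
      same-class : q ≡ p
      same-class = not-injective (trans (sym (ends-parity loop-free)) (ends-parity (step e j c w′)))

module Exchange (G : Multigraph) where

  open Incidence G
  open Walks G

  Diff : EdgeSet → EdgeSet → EdgeClass
  Diff A B p e = A e ≡ p × B e ≡ not p

  record SurplusWalk (A B : EdgeSet) : Set where
    constructor surplus-walk
    field
      {start end} : Fin (V G)
      walk : AltWalk (Diff A B) false start end
      start-surplus : deg A start < deg B start
      end-surplus : deg A end < deg B end

  -- Let u be a surplus vertex, e = uv ∈ B ∖ A and f = vw ∈ A ∖ B.
  -- A surplus walk for (A ∖ f, B ∖ e) gives one for (A, B): degrees only change at the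
  -- ends of e and f, every end of the walk other than w keeps its surplus, and an end
  -- at w is re-routed through f and e to u.
  module Reroute {A B : EdgeSet} {u v w : Fin (V G)} {e f : Fin (E G)}
    (e∈B∖A : Diff A B false e) (f∈A∖B : Diff A B true f)
    (e-uv : Joins G e u v) (f-vw : Joins G f v w)
    (e∋v : inc e v ≡ true) (f-ends : ∀ z → inc f z ≡ true → z ≡ v ⊎ z ≡ w)
    (u-surplus : deg A u < deg B u) where

    smaller-diff : ∀ {p g} → Diff (A ∖ f) (B ∖ e) p g → Diff A B p g
    smaller-diff {false} {g} (A′g , B′g) with ∖-true {P = B} B′g
    ... | Bg , _ = ∖-false {P = A} A′g g≢f , Bg
      where
      g≢f : g ≢ f
      g≢f refl with () ← trans (sym Bg) (proj₂ f∈A∖B)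
    smaller-diff {true} {g} (A′g , B′g) with ∖-true {P = A} A′g
    ... | Ag , _ = Ag , ∖-false {P = B} B′g g≢e
      where
      g≢e : g ≢ e
      g≢e refl with () ← trans (sym Ag) (proj₁ e∈B∖A)

    f-below-e : ∀ z → z ≢ w → bit (inc f z) ≤ bit (inc e z)
    f-below-e z z≢w with inc f z in f∋z
    ... | false = z≤n
    ... | true with f-ends z f∋z
    ...   | inj₁ refl = ≤-reflexive (cong bit (sym e∋v))
    ...   | inj₂ z≡w = ⊥-elim (z≢w z≡w)

    surplus-or-w : ∀ z → deg (A ∖ f) z < deg (B ∖ e) z → deg A z < deg B z ⊎ z ≡ w
    surplus-or-w z surplus with z ≟ w
    ... | yes z≡w = inj₂ z≡w
    ... | no z≢w = inj₁ (subst₂ _<_ (sym (deg-∖ A (proj₁ f∈A∖B) z)) (sym (deg-∖ B (proj₂ e∈B∖A) z))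
                                    (+-mono-<-≤ surplus (f-below-e z z≢w)))

    fix-start : ∀ {x y} → deg A x < deg B x ⊎ x ≡ w → AltWalk (Diff A B) false x y →
                ∃ λ x′ → AltWalk (Diff A B) false x′ y × deg A x′ < deg B x′
    fix-start (inj₁ x-surplus) walk = _ , walk , x-surplus
    fix-start (inj₂ refl) walk = u , step e e-uv e∈B∖A (step f f-vw f∈A∖B walk) , u-surplus

    fix-end : ∀ {x y} → deg A y < deg B y ⊎ y ≡ w → AltWalk (Diff A B) false x y →
              ∃ λ y′ → AltWalk (Diff A B) false x y′ × deg A y′ < deg B y′
    fix-end (inj₁ y-surplus) walk = _ , walk , y-surplus
    fix-end (inj₂ refl) walk =
      u , walk ++ step f (swap f-vw) f∈A∖B (step e (swap e-uv) e∈B∖A []) , u-surplus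

    lift : SurplusWalk (A ∖ f) (B ∖ e) → SurplusWalk A B
    lift (surplus-walk walk x-surplus y-surplus)
      with fix-start (surplus-or-w _ x-surplus) (map-class smaller-diff walk)
    ... | _ , walk′ , x′-surplus with fix-end (surplus-or-w _ y-surplus) walk′
    ... | _ , walk″ , y′-surplus = surplus-walk walk″ x′-surplus y′-surplus

  -- At a surplus vertex u pick e = uv ∈ B ∖ A; if v
  -- has surplus, e alone is the walk; otherwise v carries some f = vw ∈ A ∖ B, and we
  -- recurse on (A ∖ f, B ∖ e).
  exchange : ∀ n (A B : EdgeSet) → count B ≤ n → count A < count B → SurplusWalk A B
  exchange zero A B B≤0 A<B = ⊥-elim (n≮0 (<-≤-trans A<B B≤0))
  exchange (suc n) A B B≤1+n A<B with surplus-vertex A B A<B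
  ... | u , u-surplus with surplus-edge A B u u-surplus
  ... | e , Ae , Be , e∋u with other-end e u e∋u
  ... | v , e-uv , e∋v , _ with deg A v <? deg B v
  ... | yes v-surplus = surplus-walk (step e e-uv (Ae , Be) []) u-surplus v-surplus
  ... | no v-no-surplus
    with surplus-edge (B ∖ e) A v (<-≤-trans (deg-∖-< B Be v e∋v) (≮⇒≥ v-no-surplus))
  ... | f , B′f , Af , f∋v with other-end f v f∋v
  ... | w , f-vw , _ , f-ends =
    Reroute.lift (Ae , Be) (Af , ∖-false {P = B} B′f f≢e) e-uv f-vw e∋v f-ends u-surplus
      (exchange n (A ∖ f) (B ∖ e) (count-∖-≤ B Be B≤1+n) (count-∖-< A B Af Be A<B))
    where
    f≢e : f ≢ e
    f≢e refl with () ← trans (sym Af) Ae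

module Augmenting (G : Multigraph) (k : ℕ) (A : SubG G) where

  open Incidence G
  open Walks G

  InA : EdgeClass
  InA p e = lookup A e ≡ p

  to-path : ∀ {x y} (w : AltWalk InA false x y) → Simple w →
            deg (lookup A) x < k → deg (lookup A) y < k → AugmentingPath G k A
  to-path {x} {y} w simple x-deficit y-deficit = record
    { L = length w
    ; vs = vertex w
    ; es = edge w
    ; joins = joins-at w
    ; simple = simple⇒injective w simple
    ; oddLength = odd⇒%2≡1 (length w) (length-parity w)
    ; inA⇒oddIndex = λ i i∈A → odd⇒%2≡1 (toℕ i) (trans (sym (class-at w i)) ([]=⇒lookup i∈A))
    ; oddIndex⇒inA = λ i odd-i → lookup⇒[]= (edge w i) A (trans (class-at w i) (%2≡1⇒odd (toℕ i) odd-i))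
    ; startDeg = degree-bound x x-deficit
    ; endDeg = subst (λ z → degree G A z ≤ k ∸ 1) (sym (last-vertex w)) (degree-bound y y-deficit)
    }
    where
    degree-bound : ∀ z → deg (lookup A) z < k → degree G A z ≤ k ∸ 1
    degree-bound z deficit = subst₂ _≤_ (sym (degree≡deg A z)) (pred[m∸n]≡m∸[1+n] k 0) (<⇒≤pred deficit)

-- The exchange lemma gives
-- an alternating walk between vertices where deg_A < deg_B ≤ k (colourability of B);
-- shortcutting it in the bipartite graph G yields an A-augmenting path.
lemma2 : (G : Multigraph) → Bipartite G → (k : ℕ) → 1 ≤ k →
         (A : SubG G) → EdgeColorable G k A →
         (ν : ℕ) → IsNu G k ν → ∣ A ∣ < ν →
         AugmentingPath G k A
lemma2 G bip k _ A _ ν ((B , B-colourable , ∣B∣≡ν) , _) ∣A∣<ν =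
  augmenting-path (exchange (count (lookup B)) (lookup A) (lookup B) ≤-refl A<B)
  where
  open Incidence G
  open Walks G
  open Exchange G
  open Shortcut G bip
  open Augmenting G k A

  A<B : count (lookup A) < count (lookup B)
  A<B = subst₂ _<_ (∣∣≡count A) (trans (sym ∣B∣≡ν) (∣∣≡count B)) ∣A∣<ν

  below-k : ∀ z → deg (lookup A) z < deg (lookup B) z → deg (lookup A) z < k
  below-k z surplus = <-≤-trans surplus (colourable⇒deg≤ B B-colourable z)

  augmenting-path : SurplusWalk (lookup A) (lookup B) → AugmentingPath G k A
  augmenting-path (surplus-walk {x} {y} walk x-surplus y-surplus) =
    let path , simple = shortcut (map-class proj₁ walk)
    in to-path path simple (below-k x x-surplus) (below-k y y-surplus)
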